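{- For all integers $k>d\geq 1$ and $0\leq s<d$, \[\Psi(k+s,k,d)=t(k+s,k)=\binom{k+s}{2}-s.\]
   Context: A box in $\mathbb{R}^d$ is an axis-parallel box, i.e. a Cartesian product of $d$ compact intervals (degenerate intervals allowed). A family of $n$ boxes is a list of $n$ boxes (repetitions allowed); an intersecting pair is an unordered pair of distinct members with nonempty intersection. For integers $n\geq k\geq 1$, $d\geq 1$, $T(n,k,d)$ is the maximum number of intersecting pairs in a family of $n$ boxes in $\mathbb{R}^d$ such that no $k+1$ members have a point in common. For integers $n\geq m\geq 1$, $t(n,m)$ is the number of edges of the Turán graph $\mathcal{T}(n,m)$ (complete $m$-partite graph on $n$ vertices with class sizes differing by at most one), $t(n,1)=0$. For $n\geq k>d\geq 1$, $\Psi(n,k,d)=t(n-k+d,d)+T(n,k-d+1,1)$.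
   Formalization: The boxes defining $T(n,k-d+1,1)$ are intervals with rational endpoints, and their common points are taken in ℚ, instead of intervals in ℝ. -}

module Defs where

open import Data.Nat using (ℕ; zero; suc; _+_; _*_; _∸_; _<_; _≤_)
open import Data.Nat.DivMod using (_/_; _%_)
open import Data.Fin using (Fin; toℕ)
open import Data.List using (List; []; _∷_; map)
open import Data.Nat.ListAction using (sum)
open import Data.List.Base using (allFin)
open import Data.Product using (Σ; ∃; ∃-syntax; _×_; _,_; proj₁; proj₂)
open import Data.Rational as ℚ using (ℚ)
open import Function.Definitions using (Injective)
open import Relation.Binary.PropositionalEquality using (_≡_)
open import Relation.Nullary using (¬_)

-- Σ_{i<j} x_i x_j for a list of class sizes: number of edges of the
-- complete multipartite graph with these class sizes.
pairProdSum : List ℕ → ℕ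
pairProdSum []       = 0
pairProdSum (x ∷ xs) = x * sum xs + pairProdSum xs

-- Class sizes of the Turán graph T(n, m) (m = suc m'):
-- class i has size ⌊n/m⌋ + 1 if i < n mod m, else ⌊n/m⌋.
turanClasses : ℕ → ℕ → List ℕ
turanClasses n zero     = []
turanClasses n (suc m') =
  map (λ (i : Fin (suc m')) → n / suc m' + (if< (toℕ i) (n % suc m')))
      (allFin (suc m'))
  where
  if< : ℕ → ℕ → ℕ
  if< zero    zero    = 0
  if< zero    (suc _) = 1
  if< (suc a) zero    = 0
  if< (suc a) (suc b) = if< a b

t : ℕ → ℕ → ℕ
t n m = pairProdSum (turanClasses n m)

-- Boxes in ℚ^d (axis-parallel products of compact intervals [lo, hi],
-- lo ≤ hi, degenerate allowed).

record Interval : Set where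
  constructor [_,_]⟨_⟩
  field
    lo  : ℚ
    hi  : ℚ
    lo≤hi : lo ℚ.≤ hi
open Interval public

Box : ℕ → Set
Box d = Fin d → Interval

Point : ℕ → Set
Point d = Fin d → ℚ

_∈B_ : ∀ {d} → Point d → Box d → Set
_∈B_ {d} x B = ∀ (c : Fin d) → (lo (B c) ℚ.≤ x c) × (x c ℚ.≤ hi (B c))

Family : ℕ → ℕ → Set
Family n d = Fin n → Box d

NoKPlus1Common : ∀ {n d} → ℕ → Family n d → Set
NoKPlus1Common {n} {d} k F =
  ∀ (f : Fin (suc k) → Fin n) → Injective _≡_ _≡_ f →
    ¬ (∃[ x ] (∀ i → x ∈B F (f i)))

Intersect : ∀ {d} → Box d → Box d → Set
Intersect {d} A B = ∃[ x ] (x ∈B A × x ∈B B)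

-- Unordered pairs of distinct members, represented as (i , j) with i < j.
Pair : ℕ → Set
Pair n = Σ (Fin n × Fin n) λ p → toℕ (proj₁ p) < toℕ (proj₂ p)

HasIntersectingPairs : ∀ {n d} → Family n d → ℕ → Set
HasIntersectingPairs {n} F p =
  Σ (Fin p → Pair n) λ g →
    Injective _≡_ _≡_ (λ i → proj₁ (g i)) ×
    (∀ i → Intersect (F (proj₁ (proj₁ (g i)))) (F (proj₂ (proj₁ (g i)))))

-- IsT n k d m : m = T(n,k,d), the maximum number of intersecting pairs
-- in a family of n boxes in ℚ^d with no k+1 members sharing a point.
IsT : ℕ → ℕ → ℕ → ℕ → Set
IsT n k d m =
  (∃[ F ] (NoKPlus1Common k F × HasIntersectingPairs {n} {d} F m)) ×
  (∀ (F : Family n d) → NoKPlus1Common k F →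
     ∀ p → HasIntersectingPairs F p → p ≤ m)

IsΨ : ℕ → ℕ → ℕ → ℕ → Set
IsΨ n k d v = ∃[ m ] (IsT n (k ∸ d + 1) 1 m × v ≡ t (n ∸ k + d) d + m)

{-# OPTIONS --safe #-}
-- With n = k + s and e = k − d, Ψ(n, k, d) = t(s + d, d) + T(n, e + 1, 1).
--
-- For intervals, T(n, e + 1, 1) = Σ_{j<n} min(j, e). Every interval meeting the interval v
-- with the leftmost right end contains that right end, so v meets at most e others (and at
-- most n − 1); removing v and inducting gives the upper bound. Conversely, e long intervals
-- together with n − e disjoint points attain it.
--
-- Since s < d ≤ k, the Turán graph 𝒯(m + s, m) for m ∈ {d, k} is the complete graph on m + s
-- vertices minus a matching of s edges, so t(m + s, m) = C(m + s, 2) − s. With D = d + s, the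
-- identity C(e + D, 2) = C(D, 2) + Σ_{j<e+D} min(j, e) then yields the value of Ψ.
module Submission where

open import Defs
open import Data.Nat
  using (ℕ; zero; suc; _+_; _*_; _∸_; _/_; _%_; _⊓_; _<_; _≤_; _<ᵇ_; _<?_; _≤?_; z≤n; s≤s; s≤s⁻¹)
open import Data.Nat.Properties
  using (+-identityʳ; +-suc; +-comm; +-assoc; +-cancelʳ-≡; +-mono-≤; suc-injective; ≤-refl; ≤-trans; <-trans;
         <-≤-trans; <⇒≤; ≰⇒>; <-irrefl; n≤1+n; m≤m+n; m+n∸m≡n; m+n∸n≡m; m∸n+n≡m; m≤n⇒m⊓n≡m; m≥n⇒m⊓n≡n;
         m⊓n≤m; m⊓n≤n; ⊓-glb; module ≤-Reasoning)
open import Data.Nat.Combinatorics using (_C_; nCk+nC[k+1]≡[n+1]C[k+1]; nC1≡n)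
open import Data.Nat.DivMod using (m/n≡1+[m∸n]/n; m<n⇒m/n≡0; [m+n]%n≡m%n; m<n⇒m%n≡m)
open import Data.Nat.ListAction using (sum)
open import Data.Nat.Tactic.RingSolver using (solve-∀)
import Data.Nat.Coprimality as Coprime
import Data.Integer as ℤ
import Data.Integer.Properties as ℤ
open import Data.Rational as ℚ using (ℚ)
import Data.Rational.Properties as ℚ
open import Data.Bool using (true; false; if_then_else_)
import Data.Fin as Fin
open import Data.Fin using (Fin; zero; suc; toℕ; fromℕ; fromℕ<; inject₁; inject≤; _≟_)
open import Data.Fin.Properties
  using (toℕ-injective; toℕ<n; toℕ-fromℕ; toℕ-inject₁; toℕ-inject≤; fromℕ<-injective; inject₁-injective;
         inject≤-injective; fromℕ≢inject₁; injective⇒≤; <⇒≢; <-asym)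
open import Data.List using (List; []; _∷_; _++_; length; map; filter; lookup; tabulate; allFin)
open import Data.List.Properties using (map-tabulate; tabulate-cong; length-tabulate; length-map; length-++)
open import Data.List.Relation.Unary.All as All using (All; []; _∷_)
import Data.List.Relation.Unary.All.Properties as All
import Data.List.Relation.Unary.Any as Any
open import Data.List.Relation.Unary.Unique.Propositional using (Unique; []; _∷_)
import Data.List.Relation.Unary.Unique.Propositional.Properties as Unique
open import Data.List.Membership.Propositional using (_∈_)
open import Data.List.Membership.Propositional.Properties using (∈-∃++; ∈-lookup; ∈-allFin; ∈-tabulate⁻; ∈-map⁻)
open import Data.List.Relation.Binary.Disjoint.Propositional using (Disjoint)
open import Data.List.Relation.Binary.Permutation.Propositional using (_↭_)
open import Data.List.Relation.Binary.Permutation.Propositional.Properties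
  using (shift; ∈-resp-↭; ↭-length; All-resp-↭)
open import Data.Product using (∃-syntax; _×_; _,_; proj₁; proj₂)
import Data.Product as Product
open import Function using (id; _∘_)
open import Function.Definitions using (Injective)
open import Relation.Binary.Bundles using (DecTotalOrder)
open import Relation.Binary.PropositionalEquality
  using (_≡_; _≢_; refl; sym; trans; cong; cong₂; subst; subst₂; module ≡-Reasoning)
open import Relation.Nullary using (¬_; yes; no; does; contradiction)
open import Relation.Unary using (Decidable)
open import Relation.Unary.Properties using (∁?)

[1+n]C2≡n+nC2 : ∀ n → suc n C 2 ≡ n + n C 2
[1+n]C2≡n+nC2 n = trans (sym (nCk+nC[k+1]≡[n+1]C[k+1] n 1)) (cong (_+ n C 2) (nC1≡n n))

sumMin : ℕ → ℕ → ℕ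
sumMin e zero    = 0
sumMin e (suc n) = n ⊓ e + sumMin e n

n≤e⇒sumMin≡nC2 : ∀ {e} n → n ≤ e → sumMin e n ≡ n C 2
n≤e⇒sumMin≡nC2         zero    _     = refl
n≤e⇒sumMin≡nC2 {e = e} (suc n) 1+n≤e = begin
  n ⊓ e + sumMin e n  ≡⟨ cong₂ _+_ (m≤n⇒m⊓n≡m n≤e) (n≤e⇒sumMin≡nC2 n n≤e) ⟩
  n + n C 2           ≡⟨ [1+n]C2≡n+nC2 n ⟨
  suc n C 2           ∎
  where
  open ≡-Reasoning
  n≤e = <⇒≤ 1+n≤e

[e+n]C2≡nC2+sumMin : ∀ e n → (e + n) C 2 ≡ n C 2 + sumMin e (e + n)
[e+n]C2≡nC2+sumMin e zero rewrite +-identityʳ e = sym (n≤e⇒sumMin≡nC2 e ≤-refl)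
[e+n]C2≡nC2+sumMin e (suc n) = begin
  (e + suc n) C 2                                 ≡⟨ cong (_C 2) (+-suc e n) ⟩
  suc (e + n) C 2                                 ≡⟨ [1+n]C2≡n+nC2 (e + n) ⟩
  e + n + (e + n) C 2                             ≡⟨ cong (e + n +_) ([e+n]C2≡nC2+sumMin e n) ⟩
  e + n + (n C 2 + sumMin e (e + n))              ≡⟨ regroup e n (n C 2) (sumMin e (e + n)) ⟩
  (n + n C 2) + (e + sumMin e (e + n))
    ≡⟨ cong₂ _+_ ([1+n]C2≡n+nC2 n) (cong (_+ sumMin e (e + n)) (m≥n⇒m⊓n≡n (m≤m+n e n))) ⟨
  suc n C 2 + sumMin e (suc (e + n))              ≡⟨ cong (λ m → suc n C 2 + sumMin e m) (+-suc e n) ⟨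
  suc n C 2 + sumMin e (e + suc n)                ∎
  where
  open ≡-Reasoning
  regroup : ∀ e n c s → e + n + (c + s) ≡ (n + c) + (e + s)
  regroup = solve-∀

-- Turán graphs whose classes have at most two vertices

twosThenOnes : ℕ → ℕ → List ℕ
twosThenOnes zero    _       = []
twosThenOnes (suc m) zero    = 1 ∷ twosThenOnes m zero
twosThenOnes (suc m) (suc s) = 2 ∷ twosThenOnes m s

sum-twosThenOnes : ∀ m s → s ≤ m → sum (twosThenOnes m s) ≡ m + s
sum-twosThenOnes zero    zero    _         = refl
sum-twosThenOnes (suc m) zero    _         = cong suc (sum-twosThenOnes m zero z≤n)
sum-twosThenOnes (suc m) (suc s) (s≤s s≤m) = begin
  2 + sum (twosThenOnes m s) ≡⟨ cong (2 +_) (sum-twosThenOnes m s s≤m) ⟩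
  2 + (m + s)                ≡⟨ cong suc (+-suc m s) ⟨
  suc m + suc s              ∎
  where open ≡-Reasoning

pairProdSum-twosThenOnes : ∀ m s → s ≤ m → pairProdSum (twosThenOnes m s) + s ≡ (m + s) C 2
pairProdSum-twosThenOnes zero    zero    _         = refl
pairProdSum-twosThenOnes (suc m) zero    _         = begin
  1 * sum xs + pairProdSum xs + 0 ≡⟨ regroup (sum xs) (pairProdSum xs) ⟩
  sum xs + (pairProdSum xs + 0)   ≡⟨ cong₂ _+_ (sum-twosThenOnes m 0 z≤n) (pairProdSum-twosThenOnes m 0 z≤n) ⟩
  m + 0 + (m + 0) C 2             ≡⟨ [1+n]C2≡n+nC2 (m + 0) ⟨
  suc (m + 0) C 2                 ∎
  where
  open ≡-Reasoning
  xs = twosThenOnes m 0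
  regroup : ∀ a b → 1 * a + b + 0 ≡ a + (b + 0)
  regroup = solve-∀
pairProdSum-twosThenOnes (suc m) (suc s) (s≤s s≤m) = begin
  2 * sum xs + pairProdSum xs + suc s   ≡⟨ regroup (sum xs) (pairProdSum xs) s ⟩
  suc (sum xs) + (sum xs + (pairProdSum xs + s))
    ≡⟨ cong₂ (λ a b → suc a + (a + b)) (sum-twosThenOnes m s s≤m) (pairProdSum-twosThenOnes m s s≤m) ⟩
  suc (m + s) + (m + s + (m + s) C 2)   ≡⟨ cong (suc (m + s) +_) ([1+n]C2≡n+nC2 (m + s)) ⟨
  suc (m + s) + suc (m + s) C 2         ≡⟨ [1+n]C2≡n+nC2 (suc (m + s)) ⟨
  suc (suc (m + s)) C 2                 ≡⟨ cong (λ k → suc k C 2) (+-suc m s) ⟨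
  (suc m + suc s) C 2                   ∎
  where
  open ≡-Reasoning
  xs = twosThenOnes m s
  regroup : ∀ a b s → 2 * a + b + suc s ≡ suc a + (a + (b + s))
  regroup = solve-∀

-- The indicator used by Defs.turanClasses is local to its where block and cannot be named.
-- mappedFunction recovers the summand by unification; once `with` has turned the indicator's
-- arguments into variables, the use in turanClassSize-≡ determines the type left open in
-- indicator-≡, and with it the motive of lockstep-elim.
mappedFunction : ∀ {m} {f : Fin m → ℕ} xs → xs ≡ map f (allFin m) → Fin m → ℕ
mappedFunction {f = f} _ _ = f

turanClassSize : ℕ → (m : ℕ) → Fin (suc m) → ℕ
turanClassSize n m = mappedFunction (turanClasses n (suc m)) refl

lockstep-elim : {P : ℕ → ℕ → Set} → P zero zero → (∀ b → P zero (suc b)) → (∀ a → P (suc a) zero) →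
                (∀ a b → P a b → P (suc a) (suc b)) → ∀ a b → P a b
lockstep-elim p₀₀ p₀ₛ pₛ₀ pₛₛ zero    zero    = p₀₀
lockstep-elim p₀₀ p₀ₛ pₛ₀ pₛₛ zero    (suc b) = p₀ₛ b
lockstep-elim p₀₀ p₀ₛ pₛ₀ pₛₛ (suc a) zero    = pₛ₀ a
lockstep-elim p₀₀ p₀ₛ pₛ₀ pₛₛ (suc a) (suc b) = pₛₛ a b (lockstep-elim p₀₀ p₀ₛ pₛ₀ pₛₛ a b)

mutual
  turanClassSize-≡ : ∀ n m i → turanClassSize n m i ≡ n / suc m + (if toℕ i <ᵇ n % suc m then 1 else 0)
  turanClassSize-≡ n m i with toℕ i | n % suc m
  ... | a | r = cong (n / suc m +_) (indicator-≡ n m a r)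

  indicator-≡ : ∀ n m a r → _ ≡ (if a <ᵇ r then 1 else 0)
  indicator-≡ _ _ = lockstep-elim refl (λ _ → refl) (λ _ → refl) (λ _ _ → id)

tabulate-twosThenOnes : ∀ m s → tabulate {n = m} (λ i → 1 + (if toℕ i <ᵇ s then 1 else 0)) ≡ twosThenOnes m s
tabulate-twosThenOnes zero    s       = refl
tabulate-twosThenOnes (suc m) zero    = cong (1 ∷_) (tabulate-twosThenOnes m zero)
tabulate-twosThenOnes (suc m) (suc s) = cong (2 ∷_) (tabulate-twosThenOnes m s)

turanClasses-+ : ∀ m s → s < suc m → turanClasses (suc m + s) (suc m) ≡ twosThenOnes (suc m) s
turanClasses-+ m s s<1+m = begin
  turanClasses n (suc m)                                                 ≡⟨ map-tabulate id (turanClassSize n m) ⟩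
  tabulate (turanClassSize n m)                                          ≡⟨ tabulate-cong (turanClassSize-≡ n m) ⟩
  tabulate (λ i → n / suc m + (if toℕ i <ᵇ n % suc m then 1 else 0))
    ≡⟨ tabulate-cong (λ i → cong₂ (λ q r → q + (if toℕ i <ᵇ r then 1 else 0)) quotient remainder) ⟩
  tabulate (λ i → 1 + (if toℕ i <ᵇ s then 1 else 0))                     ≡⟨ tabulate-twosThenOnes (suc m) s ⟩
  twosThenOnes (suc m) s                                                 ∎
  where
  open ≡-Reasoning
  n = suc m + s
  quotient : n / suc m ≡ 1
  quotient = trans (m/n≡1+[m∸n]/n (m≤m+n (suc m) s))
                   (cong suc (trans (cong (_/ suc m) (m+n∸m≡n (suc m) s)) (m<n⇒m/n≡0 s<1+m)))
  remainder : n % suc m ≡ s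
  remainder = trans (cong (_% suc m) (+-comm (suc m) s)) (trans ([m+n]%n≡m%n s (suc m)) (m<n⇒m%n≡m s<1+m))

t[m+s,m]+s≡[m+s]C2 : ∀ m s → s < m → t (m + s) m + s ≡ (m + s) C 2
t[m+s,m]+s≡[m+s]C2 (suc m) s s<m =
  trans (cong (λ cs → pairProdSum cs + s) (turanClasses-+ m s s<m)) (pairProdSum-twosThenOnes (suc m) s (<⇒≤ s<m))

t[k+s,k]≡t[d+s,d]+sumMin : ∀ k d s → d ≤ k → s < d → t (k + s) k ≡ t (d + s) d + sumMin (k ∸ d) (k + s)
t[k+s,k]≡t[d+s,d]+sumMin k d s d≤k s<d = +-cancelʳ-≡ s _ _ (begin
  t (k + s) k + s                                     ≡⟨ t[m+s,m]+s≡[m+s]C2 k s (<-≤-trans s<d d≤k) ⟩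
  (k + s) C 2                                         ≡⟨ cong (_C 2) k+s≡e+[d+s] ⟩
  (e + (d + s)) C 2                                   ≡⟨ [e+n]C2≡nC2+sumMin e (d + s) ⟩
  (d + s) C 2 + sumMin e (e + (d + s))
    ≡⟨ cong₂ _+_ (t[m+s,m]+s≡[m+s]C2 d s s<d) (cong (sumMin e) k+s≡e+[d+s]) ⟨
  t (d + s) d + s + sumMin e (k + s)                  ≡⟨ swap (t (d + s) d) s (sumMin e (k + s)) ⟩
  t (d + s) d + sumMin e (k + s) + s                  ∎)
  where
  open ≡-Reasoning
  e = k ∸ d
  k+s≡e+[d+s] : k + s ≡ e + (d + s)
  k+s≡e+[d+s] = trans (cong (_+ s) (sym (m∸n+n≡m d≤k))) (+-assoc e d s)
  swap : ∀ a b c → a + b + c ≡ a + c + b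
  swap = solve-∀

module _ {A : Set} where

  ∈⇒↭∷ : ∀ {x : A} {xs} → x ∈ xs → ∃[ ys ] xs ↭ x ∷ ys
  ∈⇒↭∷ x∈xs with ys , zs , refl ← ∈-∃++ x∈xs = ys ++ zs , shift _ ys zs

  Unique⇒length≤ : ∀ {xs ys : List A} → Unique xs → All (_∈ ys) xs → length xs ≤ length ys
  Unique⇒length≤ []            []              = z≤n
  Unique⇒length≤ {x ∷ xs} {ys} (x∉xs ∷ xs!) (x∈ys ∷ xs⊆ys) with ys′ , ys↭x∷ys′ ← ∈⇒↭∷ x∈ys = begin
    suc (length xs)  ≤⟨ s≤s (Unique⇒length≤ xs! (All.zipWith ∈ys′ (x∉xs , xs⊆ys))) ⟩
    suc (length ys′) ≡⟨ ↭-length ys↭x∷ys′ ⟨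
    length ys        ∎
    where
    open ≤-Reasoning
    ∈ys′ : ∀ {y} → x ≢ y × y ∈ ys → y ∈ ys′
    ∈ys′ (x≢y , y∈ys) = Any.tail (x≢y ∘ sym) (∈-resp-↭ ys↭x∷ys′ y∈ys)

  lookup-injective : ∀ {xs : List A} → Unique xs → Injective _≡_ _≡_ (lookup xs)
  lookup-injective (_ ∷ _)     {zero}  {zero}  _  = refl
  lookup-injective (x∉xs ∷ _)  {zero}  {suc j} eq = contradiction eq (All.lookup x∉xs (∈-lookup j))
  lookup-injective (x∉xs ∷ _)  {suc i} {zero}  eq = contradiction (sym eq) (All.lookup x∉xs (∈-lookup i))
  lookup-injective (_ ∷ xs!)   {suc i} {suc j} eq = cong suc (lookup-injective xs! eq)

  map⁺-injectiveOn : ∀ {B : Set} {P : A → Set} {f : A → B} {xs} → (∀ {x y} → P x → P y → f x ≡ f y → x ≡ y) →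
                     All P xs → Unique xs → Unique (map f xs)
  map⁺-injectiveOn _   []         []           = []
  map⁺-injectiveOn inj (px ∷ pxs) (x∉xs ∷ xs!) =
    All.map⁺ (All.zipWith (λ (py , x≢y) fx≡fy → x≢y (inj px py fx≡fy)) (pxs , x∉xs)) ∷ map⁺-injectiveOn inj pxs xs!

  length-filter+filter-∁ : ∀ {P : A → Set} (P? : Decidable P) xs →
                           length (filter P? xs) + length (filter (∁? P?) xs) ≡ length xs
  length-filter+filter-∁ P? []       = refl
  length-filter+filter-∁ P? (x ∷ xs) with does (P? x)
  ... | true  = cong suc (length-filter+filter-∁ P? xs)
  ... | false = trans (+-suc _ _) (cong suc (length-filter+filter-∁ P? xs))

module _ {A : Set} (f : A → ℚ) where
  open import Data.List.Extrema (DecTotalOrder.totalOrder ℚ.≤-decTotalOrder)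

  ↭-argmin∷ : ∀ x xs → ∃[ v ] ∃[ ys ] x ∷ xs ↭ v ∷ ys × All (λ y → f v ℚ.≤ f y) ys
  ↭-argmin∷ x xs with ys , x∷xs↭ ← ∈⇒↭∷ (argmin-all f (Any.here refl) (All.tabulate Any.there)) =
    _ , ys , x∷xs↭ , All.tail (All-resp-↭ x∷xs↭ (f[argmin]≤f[⊤] {f = f} x xs ∷ f[argmin]≤f[xs] {f = f} x xs))

module _ {n d : ℕ} (F : Family n d) where

  IntersectingPair : Fin n × Fin n → Set
  IntersectingPair p = proj₁ p Fin.< proj₂ p × Intersect (F (proj₁ p)) (F (proj₂ p))

  HasIntersectingPairs⇒list : ∀ {p} → HasIntersectingPairs F p →
                              ∃[ L ] length L ≡ p × Unique L × All IntersectingPair L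
  HasIntersectingPairs⇒list (g , g-injective , g-intersecting) =
    tabulate (proj₁ ∘ g) , length-tabulate _ , Unique.tabulate⁺ g-injective ,
    All.tabulate⁺ (λ l → proj₂ (g l) , g-intersecting l)

  list⇒HasIntersectingPairs : ∀ {L} → Unique L → All IntersectingPair L → HasIntersectingPairs F (length L)
  list⇒HasIntersectingPairs {L} L! L-intersecting =
    (λ l → lookup L l , proj₁ (intersecting l)) , lookup-injective L! , proj₂ ∘ intersecting
    where
    intersecting : ∀ l → IntersectingPair (lookup L l)
    intersecting l = All.lookup L-intersecting (∈-lookup l)

  commonPoint-length≤ : ∀ {k} → NoKPlus1Common k F → ∀ {x U} → Unique U → All (λ i → x ∈B F i) U → length U ≤ k
  commonPoint-length≤ {k} noCommon {x} {U} U! x∈U with length U ≤? k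
  ... | yes |U|≤k = |U|≤k
  ... | no  |U|≰k =
    contradiction (x , λ a → All.lookup x∈U (∈-lookup (position a))) (noCommon member member-injective)
    where
    position : Fin (suc k) → Fin (length U)
    position a = inject≤ a (≰⇒> |U|≰k)
    member : Fin (suc k) → Fin n
    member = lookup U ∘ position
    member-injective : Injective _≡_ _≡_ member
    member-injective eq = inject≤-injective _ _ _ _ (lookup-injective U! eq)

-- Families of intervals: the upper bound

data Involves {n} (v : Fin n) : Fin n × Fin n → Set where
  first  : ∀ {u} → Involves v (v , u)
  second : ∀ {u} → Involves v (u , v)

involves? : ∀ {n} (v : Fin n) → Decidable (Involves v)
involves? v (i , j) with i ≟ v | j ≟ v
... | yes refl | _        = yes first
... | no _     | yes refl = yes second
... | no i≢v   | no j≢v   = no λ { first → i≢v refl ; second → j≢v refl }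

partner : ∀ {n} → Fin n → Fin n × Fin n → Fin n
partner v (i , j) with i ≟ v
... | yes _ = j
... | no  _ = i

partner-first : ∀ {n} (v : Fin n) {u} → partner v (v , u) ≡ u
partner-first v with v ≟ v
... | yes _   = refl
... | no v≢v = contradiction refl v≢v

partner-second : ∀ {n} {v u : Fin n} → u ≢ v → partner v (u , v) ≡ u
partner-second {v = v} {u} u≢v with u ≟ v
... | yes u≡v = contradiction u≡v u≢v
... | no _    = refl

module _ {n : ℕ} (F : Family n 1) {e : ℕ} (noCommon : NoKPlus1Common (suc e) F) where

  rightEnd : Fin n → ℚ
  rightEnd i = hi (F i zero)

  IntersectingPairWithin : List (Fin n) → Fin n × Fin n → Set
  IntersectingPairWithin S p = (proj₁ p ∈ S × proj₂ p ∈ S) × IntersectingPair F p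

  module _ {v : Fin n} {S : List (Fin n)} (v-leftmost : All (λ u → rightEnd v ℚ.≤ rightEnd u) (v ∷ S)) where

    Neighbour : Fin n → Set
    Neighbour u = u ∈ S × (λ _ → rightEnd v) ∈B F u × v ≢ u

    neighbour : ∀ {u} → u ∈ v ∷ S → v ≢ u → Intersect (F v) (F u) → Neighbour u
    neighbour u∈v∷S v≢u (_ , x∈Fv , x∈Fu) = Any.tail (v≢u ∘ sym) u∈v∷S , rightEnd∈Fu , v≢u
      where
      rightEnd∈Fu : (λ _ → rightEnd v) ∈B F _
      rightEnd∈Fu zero = ℚ.≤-trans (proj₁ (x∈Fu zero)) (proj₂ (x∈Fv zero)) , All.lookup v-leftmost u∈v∷S

    partner-neighbour : ∀ {p} → IntersectingPairWithin (v ∷ S) p → Involves v p → Neighbour (partner v p)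
    partner-neighbour ((_ , u∈v∷S) , v<u , meet) first =
      subst Neighbour (sym (partner-first v)) (neighbour u∈v∷S (<⇒≢ v<u) meet)
    partner-neighbour ((u∈v∷S , _) , u<v , (x , x∈Fu , x∈Fv)) second =
      subst Neighbour (sym (partner-second (<⇒≢ u<v))) (neighbour u∈v∷S (<⇒≢ u<v ∘ sym) (x , x∈Fv , x∈Fu))

    first≢second : ∀ {u u′} → v Fin.< u → u′ Fin.< v → partner v (v , u) ≢ partner v (u′ , v)
    first≢second v<u u′<v eq = <-asym v<u (subst (Fin._< v) u′≡u u′<v)
      where u′≡u = trans (sym (partner-second (<⇒≢ u′<v))) (trans (sym eq) (partner-first v))

    partner-injectiveOn : ∀ {p q} → IntersectingPairWithin (v ∷ S) p × Involves v p →
                          IntersectingPairWithin (v ∷ S) q × Involves v q → partner v p ≡ partner v q → p ≡ q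
    partner-injectiveOn (_ , first) (_ , first) eq =
      cong (v ,_) (trans (sym (partner-first v)) (trans eq (partner-first v)))
    partner-injectiveOn ((_ , v<u , _) , first) ((_ , u′<v , _) , second) eq =
      contradiction eq (first≢second v<u u′<v)
    partner-injectiveOn ((_ , u<v , _) , second) ((_ , v<u′ , _) , first) eq =
      contradiction (sym eq) (first≢second v<u′ u<v)
    partner-injectiveOn ((_ , u<v , _) , second) ((_ , u′<v , _) , second) eq =
      cong (_, v) (trans (sym (partner-second (<⇒≢ u<v))) (trans eq (partner-second (<⇒≢ u′<v))))

    involving-length≤ : ∀ {L} → Unique L → All (λ p → IntersectingPairWithin (v ∷ S) p × Involves v p) L →
                        length L ≤ length S ⊓ e
    involving-length≤ {L} L! L-involving = begin
      length L                  ≡⟨ length-map (partner v) L ⟨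
      length (map (partner v) L) ≤⟨ ⊓-glb (Unique⇒length≤ U! (All.map proj₁ U-neighbours)) (s≤s⁻¹ v∷U-length≤) ⟩
      length S ⊓ e              ∎
      where
      open ≤-Reasoning
      U! : Unique (map (partner v) L)
      U! = map⁺-injectiveOn partner-injectiveOn L-involving L!
      U-neighbours : All Neighbour (map (partner v) L)
      U-neighbours = All.map⁺ (All.map (λ (p∈ , involves) → partner-neighbour p∈ involves) L-involving)
      rightEnd∈Fv : (λ _ → rightEnd v) ∈B F v
      rightEnd∈Fv zero = lo≤hi (F v zero) , ℚ.≤-refl
      v∷U-length≤ : suc (length (map (partner v) L)) ≤ suc e
      v∷U-length≤ = commonPoint-length≤ F noCommon (All.map (proj₂ ∘ proj₂) U-neighbours ∷ U!)
                                         (rightEnd∈Fv ∷ All.map (proj₁ ∘ proj₂) U-neighbours)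

  pairsWithin-length≤ : ∀ m {S} → length S ≡ m →
                        ∀ {L} → Unique L → All (IntersectingPairWithin S) L → length L ≤ sumMin e m
  pairsWithin-length≤ zero    {[]}     _ {[]}    _ _                     = z≤n
  pairsWithin-length≤ zero    {[]}     _ {_ ∷ _} _ (((() , _) , _) ∷ _)
  pairsWithin-length≤ (suc m) {s ∷ S₀} |s∷S₀|≡1+m {L} L! L-in
    with v , S , s∷S₀↭v∷S , v-leftmost ← ↭-argmin∷ rightEnd s S₀ = begin
    length L                                               ≡⟨ length-filter+filter-∁ (involves? v) L ⟨
    length (filter (involves? v) L) + length (filter (∁? (involves? v)) L)
      ≤⟨ +-mono-≤ (involving-length≤ (ℚ.≤-refl ∷ v-leftmost) (Unique.filter⁺ _ L!) involving)
                  (pairsWithin-length≤ m |S|≡m (Unique.filter⁺ _ L!) avoiding) ⟩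
    length S ⊓ e + sumMin e m                              ≡⟨ cong (λ k → k ⊓ e + sumMin e m) |S|≡m ⟩
    m ⊓ e + sumMin e m                                     ∎
    where
    open ≤-Reasoning
    |S|≡m : length S ≡ m
    |S|≡m = suc-injective (trans (sym (↭-length s∷S₀↭v∷S)) |s∷S₀|≡1+m)
    relocate : ∀ {p} → IntersectingPairWithin (s ∷ S₀) p → IntersectingPairWithin (v ∷ S) p
    relocate ((i∈ , j∈) , ij) = (∈-resp-↭ s∷S₀↭v∷S i∈ , ∈-resp-↭ s∷S₀↭v∷S j∈) , ij
    drop-v : ∀ {p} → IntersectingPairWithin (v ∷ S) p → ¬ Involves v p → IntersectingPairWithin S p
    drop-v ((i∈ , j∈) , ij) v∉p =
      (Any.tail (λ { refl → v∉p first }) i∈ , Any.tail (λ { refl → v∉p second }) j∈) , ij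
    involving : All (λ p → IntersectingPairWithin (v ∷ S) p × Involves v p) (filter (involves? v) L)
    involving = All.zipWith (λ (p∈ , v∈p) → relocate p∈ , v∈p)
                            (All.filter⁺ (involves? v) L-in , All.all-filter (involves? v) L)
    avoiding : All (IntersectingPairWithin S) (filter (∁? (involves? v)) L)
    avoiding = All.zipWith (λ (p∈ , v∉p) → drop-v (relocate p∈) v∉p)
                           (All.filter⁺ (∁? (involves? v)) L-in , All.all-filter (∁? (involves? v)) L)

  intersectingPairs≤sumMin : ∀ {p} → HasIntersectingPairs F p → p ≤ sumMin e n
  intersectingPairs≤sumMin hasPairs with L , refl , L! , L-intersecting ← HasIntersectingPairs⇒list F hasPairs =
    pairsWithin-length≤ n (length-tabulate id) L! (All.map ((∈-allFin _ , ∈-allFin _) ,_) L-intersecting)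

-- Families of intervals: a family attaining the bound

toℚ : ℕ → ℚ
toℚ j = ℚ.mkℚ (ℤ.+ j) 0 (Coprime.sym (Coprime.1-coprimeTo j))

toℚ-mono-≤ : ∀ {a b} → a ≤ b → toℚ a ℚ.≤ toℚ b
toℚ-mono-≤ a≤b = ℚ.*≤* (subst₂ ℤ._≤_ (sym (ℤ.*-identityʳ _)) (sym (ℤ.*-identityʳ _)) (ℤ.+≤+ a≤b))

toℚ-injective : ∀ {a b} → toℚ a ≡ toℚ b → a ≡ b
toℚ-injective eq = ℤ.+-injective (cong ℚ.numerator eq)

_∈ᴵ_ : ℚ → Interval → Set
y ∈ᴵ I = lo I ℚ.≤ y × y ℚ.≤ hi I

module _ (e n : ℕ) where

  longOrPoint : ℕ → Interval
  longOrPoint j with j <? e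
  ... | yes _ = [ toℚ 0 , toℚ n ]⟨ toℚ-mono-≤ z≤n ⟩
  ... | no  _ = [ toℚ j , toℚ j ]⟨ ℚ.≤-refl ⟩

  longsAndPoints : Family n 1
  longsAndPoints i _ = longOrPoint (toℕ i)

  ∈-long : ∀ {i y} → i < e → y ≤ n → toℚ y ∈ᴵ longOrPoint i
  ∈-long {i} i<e y≤n with i <? e
  ... | yes _   = toℚ-mono-≤ z≤n , toℚ-mono-≤ y≤n
  ... | no i≮e = contradiction i<e i≮e

  ∈-longOrPoint : ∀ {j} → j ≤ n → toℚ j ∈ᴵ longOrPoint j
  ∈-longOrPoint {j} j≤n with j <? e
  ... | yes _ = toℚ-mono-≤ z≤n , toℚ-mono-≤ j≤n
  ... | no  _ = ℚ.≤-refl , ℚ.≤-refl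

  -- A pigeonhole map: long intervals get distinct slots and all points share the last one,
  -- but distinct points are disjoint.
  slot : ℕ → Fin (suc e)
  slot j with j <? e
  ... | yes j<e = inject₁ (fromℕ< j<e)
  ... | no  _   = fromℕ e

  slot-injectiveOn : ∀ {i j y} → y ∈ᴵ longOrPoint i → y ∈ᴵ longOrPoint j → slot i ≡ slot j → i ≡ j
  slot-injectiveOn {i} {j} y∈i y∈j eq with i <? e | j <? e
  ... | yes i<e | yes j<e = fromℕ<-injective i j i<e j<e (inject₁-injective eq)
  ... | yes _   | no  _   = contradiction (sym eq) fromℕ≢inject₁
  ... | no  _   | yes _   = contradiction eq fromℕ≢inject₁
  ... | no  _   | no  _   =
    toℚ-injective (ℚ.≤-antisym (ℚ.≤-trans (proj₁ y∈i) (proj₂ y∈j)) (ℚ.≤-trans (proj₁ y∈j) (proj₂ y∈i)))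

  longsAndPoints-noCommon : NoKPlus1Common (suc e) longsAndPoints
  longsAndPoints-noCommon f f-injective (_ , x∈) = <-irrefl refl (injective⇒≤ slot∘f-injective)
    where
    slot∘f-injective : ∀ {a b} → slot (toℕ (f a)) ≡ slot (toℕ (f b)) → a ≡ b
    slot∘f-injective {a} {b} eq = f-injective (toℕ-injective (slot-injectiveOn (x∈ a Fin.zero) (x∈ b Fin.zero) eq))

LongPair : ∀ {n} → ℕ → Fin n × Fin n → Set
LongPair e p = proj₁ p Fin.< proj₂ p × toℕ (proj₁ p) < e

pairWithLast : ∀ e n → Fin (n ⊓ e) → Fin (suc n) × Fin (suc n)
pairWithLast e n a = inject≤ a (≤-trans (m⊓n≤m n e) (n≤1+n n)) , fromℕ n

injectPair : ∀ {n} → Fin n × Fin n → Fin (suc n) × Fin (suc n)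
injectPair = Product.map inject₁ inject₁

injectPair-injective : ∀ {n} → Injective _≡_ _≡_ (injectPair {n})
injectPair-injective eq = cong₂ _,_ (inject₁-injective (cong proj₁ eq)) (inject₁-injective (cong proj₂ eq))

longPairs : ℕ → (n : ℕ) → List (Fin n × Fin n)
longPairs e zero    = []
longPairs e (suc n) = tabulate (pairWithLast e n) ++ map injectPair (longPairs e n)

length-longPairs : ∀ e n → length (longPairs e n) ≡ sumMin e n
length-longPairs e zero    = refl
length-longPairs e (suc n) =
  trans (length-++ (tabulate (pairWithLast e n)))
        (cong₂ _+_ (length-tabulate _) (trans (length-map _ (longPairs e n)) (length-longPairs e n)))

longPairs-long : ∀ e n → All (LongPair e) (longPairs e n)
longPairs-long e zero    = []
longPairs-long e (suc n) =
  All.++⁺ (All.tabulate⁺ pairWithLast-long) (All.map⁺ (All.map injectPair-long (longPairs-long e n)))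
  where
  pairWithLast-long : ∀ a → LongPair e (pairWithLast e n a)
  pairWithLast-long a = subst₂ _<_ (sym (toℕ-inject≤ a _)) (sym (toℕ-fromℕ n)) (<-≤-trans (toℕ<n a) (m⊓n≤m n e)) ,
                   subst (_< e) (sym (toℕ-inject≤ a _)) (<-≤-trans (toℕ<n a) (m⊓n≤n n e))
  injectPair-long : ∀ {p} → LongPair e p → LongPair e (injectPair p)
  injectPair-long {i , j} (i<j , i<e) = subst₂ _<_ (sym (toℕ-inject₁ i)) (sym (toℕ-inject₁ j)) i<j ,
                                     subst (_< e) (sym (toℕ-inject₁ i)) i<e

longPairs-unique : ∀ e n → Unique (longPairs e n)
longPairs-unique e zero    = []
longPairs-unique e (suc n) =
  Unique.++⁺ (Unique.tabulate⁺ (λ eq → inject≤-injective _ _ _ _ (cong proj₁ eq)))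
             (Unique.map⁺ injectPair-injective (longPairs-unique e n))
             new∉old
  where
  new∉old : Disjoint (tabulate (pairWithLast e n)) (map injectPair (longPairs e n))
  new∉old (p∈new , p∈old) with ∈-tabulate⁻ p∈new | ∈-map⁻ injectPair p∈old
  ... | _ , refl | _ , _ , eq = fromℕ≢inject₁ (cong proj₂ eq)

longPair-intersecting : ∀ e n {p} → LongPair e p → IntersectingPair (longsAndPoints e n) p
longPair-intersecting e n {_ , j} (i<j , i<e) =
  i<j , (λ _ → toℚ (toℕ j)) , (λ _ → ∈-long e n i<e j≤n) , (λ _ → ∈-longOrPoint e n j≤n)
  where j≤n = <⇒≤ (toℕ<n j)

longsAndPoints-pairs : ∀ e n → HasIntersectingPairs (longsAndPoints e n) (sumMin e n)
longsAndPoints-pairs e n =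
  subst (HasIntersectingPairs (longsAndPoints e n)) (length-longPairs e n)
        (list⇒HasIntersectingPairs (longsAndPoints e n) (longPairs-unique e n)
                                   (All.map (longPair-intersecting e n) (longPairs-long e n)))

T[n,e+1,1]≡sumMin : ∀ n e → IsT n (suc e) 1 (sumMin e n)
T[n,e+1,1]≡sumMin n e =
  (longsAndPoints e n , longsAndPoints-noCommon e n , longsAndPoints-pairs e n) ,
  λ F noCommon _ → intersectingPairs≤sumMin F noCommon

proposition1 : ∀ (k d s : ℕ) → 1 ≤ d → d < k → s < d →
    IsΨ (k + s) k d (t (k + s) k) × t (k + s) k ≡ (k + s) C 2 ∸ s
proposition1 k d s _ d<k s<d = (sumMin (k ∸ d) (k + s) , T-value , Ψ-value) , t-value
  where
  T-value : IsT (k + s) (k ∸ d + 1) 1 (sumMin (k ∸ d) (k + s))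
  T-value = subst (λ k′ → IsT (k + s) k′ 1 (sumMin (k ∸ d) (k + s))) (+-comm 1 (k ∸ d))
                  (T[n,e+1,1]≡sumMin (k + s) (k ∸ d))
  k+s∸k+d≡d+s : k + s ∸ k + d ≡ d + s
  k+s∸k+d≡d+s = trans (cong (_+ d) (m+n∸m≡n k s)) (+-comm s d)
  Ψ-value : t (k + s) k ≡ t (k + s ∸ k + d) d + sumMin (k ∸ d) (k + s)
  Ψ-value = trans (t[k+s,k]≡t[d+s,d]+sumMin k d s (<⇒≤ d<k) s<d)
                  (cong (λ m → t m d + sumMin (k ∸ d) (k + s)) (sym k+s∸k+d≡d+s))
  t-value : t (k + s) k ≡ (k + s) C 2 ∸ s
  t-value = trans (sym (m+n∸n≡m (t (k + s) k) s)) (cong (_∸ s) (t[m+s,m]+s≡[m+s]C2 k s (<-trans s<d d<k)))
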